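{- Let $n\ge0$, let $\alpha$ be a composition of $n$, and let $F,G\in\Sigma_n$ be such that $\operatorname{type}G=\alpha$ and $F\not\preceq G$. Then $n_\alpha(FG)>n_\alpha(F)$.
   Context: A set composition of $[n]=\{1,\ldots,n\}$ is a tuple $F=(F_1,\ldots,F_k)$ of nonempty pairwise disjoint sets with union $[n]$, of type $(|F_1|,\ldots,|F_k|)$; $\Sigma_n$ is the set of all of them. The product of $F=(F_1,\ldots,F_k)$ and $G=(G_1,\ldots,G_m)$ is the tuple of the intersections $F_i\cap G_j$ in lexicographic order of $(i,j)$, with empty sets removed. $F\preceq G$ means every block of $F$ is a subset of some block of $G$. $n_\alpha(F)=\#\{H\in\Sigma_n:F\preceq H,\ \operatorname{type}H=\alpha\}$. -}

module Defs where

open import Data.Nat using (ℕ; zero; suc; _≤_; _<_)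
open import Data.Nat.Properties using () renaming (_≟_ to _≟ℕ_)
open import Data.Bool using (Bool; true; false)
open import Data.Bool.Properties using () renaming (_≟_ to _≟B_)
open import Data.Vec using (Vec; []; _∷_)
open import Data.Vec.Properties using (≡-dec)
open import Data.List using (List; []; _∷_; map; concatMap; filter; length)
open import Data.Nat.ListAction using (sum)
open import Data.List.Relation.Unary.All using (All; all?)
open import Data.List.Relation.Unary.Any using (Any; any?)
open import Data.List.Relation.Unary.AllPairs using (AllPairs; allPairs?)
open import Data.Fin.Subset using (Subset; Nonempty; Empty; _⊆_; _∩_; ⋃; ⊤; ∣_∣)
open import Data.Fin.Subset.Properties using (nonempty?; _⊆?_)
open import Data.Product using (_×_)
open import Relation.Nullary using (Dec; ¬_; ¬?)
open import Relation.Nullary.Decidable using (_×-dec_)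
open import Relation.Binary.PropositionalEquality using (_≡_)

-- A (raw) tuple of subsets of [n] = {0,…,n-1}  (Fin n)
Tuple : ℕ → Set
Tuple n = List (Subset n)

IsSetComp : ∀ {n} → Tuple n → Set
IsSetComp {n} F = All Nonempty F × AllPairs (λ A B → Empty (A ∩ B)) F × ⋃ F ≡ ⊤

isSetComp? : ∀ {n} (F : Tuple n) → Dec (IsSetComp F)
isSetComp? F =
  all? nonempty? F ×-dec
  (allPairs? (λ A B → ¬? (nonempty? (A ∩ B))) F ×-dec
   ≡-dec _≟B_ (⋃ F) ⊤)

record SetComp (n : ℕ) : Set where
  constructor mkSetComp
  field
    blocks : Tuple n
    isSetComp : IsSetComp blocks
open SetComp public

record Composition (n : ℕ) : Set where
  constructor mkComposition
  field
    parts : List ℕ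
    positive : All (λ a → 1 ≤ a) parts
    sums : sum parts ≡ n
open Composition public

typeOf : ∀ {n} → Tuple n → List ℕ
typeOf F = map ∣_∣ F

prod : ∀ {n} → Tuple n → Tuple n → Tuple n
prod F G = filter nonempty? (concatMap (λ A → map (λ B → A ∩ B) G) F)

_·_ : ∀ {n} → SetComp n → SetComp n → Tuple n
F · G = prod (blocks F) (blocks G)

_⪯_ : ∀ {n} → Tuple n → Tuple n → Set
F ⪯ G = All (λ A → Any (λ B → A ⊆ B) G) F

_⪯?_ : ∀ {n} (F G : Tuple n) → Dec (F ⪯ G)
F ⪯? G = all? (λ A → any? (λ B → A ⊆? B) G) F

allSubsets : ∀ n → List (Subset n)
allSubsets zero = [] ∷ []
allSubsets (suc n) = concatMap (λ b → map (b ∷_) (allSubsets n)) (true ∷ false ∷ [])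

allTuples : ∀ n → ℕ → List (Tuple n)
allTuples n zero = [] ∷ []
allTuples n (suc k) = concatMap (λ A → map (A ∷_) (allTuples n k)) (allSubsets n)

typeEq? : (a b : List ℕ) → Dec (a ≡ b)
typeEq? = Data.List.Properties.≡-dec _≟ℕ_
  where import Data.List.Properties

-- n_α(F) = #{H ∈ Σ_n : F ⪯ H, type H = α}
-- (every H of type α has length α blocks, so enumerating tuples of that length is exhaustive)
nα : ∀ {n} → Composition n → Tuple n → ℕ
nα {n} α F = length (filter (λ H → isSetComp? H ×-dec (typeEq? (typeOf H) (parts α) ×-dec F ⪯? H))
                            (allTuples n (length (parts α))))

{-# OPTIONS --safe #-}
-- Since FG refines F, every H of type α with F ⪯ H also satisfies FG ⪯ H, so
-- n_α(F) ≤ n_α(FG). The inequality is strict because G itself is counted by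
-- n_α(FG) (it has type α and FG refines G) but not by n_α(F), as F ⋠ G.
module Submission where

open import Defs
open import Data.Nat using (ℕ; zero; suc; _>_; _<_)
open import Data.Nat.Properties using (≤∧≢⇒<)
open import Data.Bool using (Bool; true; false)
open import Data.Vec using ([]; _∷_)
open import Data.List using (List; []; _∷_; map; filter; length)
open import Data.List.Properties using (length-map)
import Data.List.Relation.Unary.All as All
open import Data.List.Relation.Unary.Any as Any using (Any; here; there)
open import Data.List.Membership.Propositional using (_∈_; find; lose)
open import Data.List.Membership.Propositional.Properties
  using (∈-map⁺; ∈-map⁻; ∈-filter⁺; ∈-filter⁻; ∈-concatMap⁺; ∈-concatMap⁻)
open import Data.List.Relation.Binary.Sublist.Propositional using (_⊆_; ⊆-refl)
open import Data.List.Relation.Binary.Sublist.Heterogeneous.Properties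
  using (length-mono-≤; toPointwise; ⊆-filter-Sublist)
open import Data.List.Relation.Binary.Pointwise using (Pointwise-≡⇒≡)
open import Data.Fin.Subset using (Subset; _∩_; ∣_∣) renaming (_⊆_ to _⊆ₛ_)
open import Data.Fin.Subset.Properties using (⊆-trans; p∩q⊆p; p∩q⊆q)
open import Data.Product using (_×_; _,_; proj₁; proj₂; ∃₂)
open import Function using (case_of_)
open import Relation.Nullary using (¬_)
open import Relation.Nullary.Decidable using (_×-dec_)
open import Relation.Unary using (Pred; Decidable)
open import Relation.Binary.PropositionalEquality using (_≡_; _≢_; refl; sym; trans; cong; subst)
open import Level using (Level)

module _ {a p q : Level} {A : Set a} {P : Pred A p} {Q : Pred A q}
         (P? : Decidable P) (Q? : Decidable Q) (P⇒Q : ∀ {x} → P x → Q x) where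

  filter-⊆-filter : (xs : List A) → filter P? xs ⊆ filter Q? xs
  filter-⊆-filter xs = ⊆-filter-Sublist P? Q? (λ { refl → P⇒Q }) (⊆-refl {x = xs})

  -- Equal lengths would make the sublist inclusion an equality, putting x into filter P? xs.
  length-filter-< : ∀ {x} xs → x ∈ xs → Q x → ¬ P x →
                    length (filter P? xs) < length (filter Q? xs)
  length-filter-< {x} xs x∈xs Qx ¬Px = ≤∧≢⇒< (length-mono-≤ sub) lengths≢
    where
    sub = filter-⊆-filter xs
    lengths≢ : length (filter P? xs) ≢ length (filter Q? xs)
    lengths≢ eq = ¬Px (proj₂ (∈-filter⁻ P? {xs = xs} x∈filterP))
      where
      filters≡ = sym (Pointwise-≡⇒≡ (toPointwise eq sub))
      x∈filterP = subst (x ∈_) filters≡ (∈-filter⁺ Q? x∈xs Qx)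

module _ {n : ℕ} where

  ∈-prod⁻ : ∀ {C : Subset n} (F G : Tuple n) → C ∈ prod F G →
            ∃₂ λ A B → A ∈ F × B ∈ G × C ≡ A ∩ B
  ∈-prod⁻ F G C∈FG with find (∈-concatMap⁻ _ {xs = F} (proj₁ (∈-filter⁻ _ C∈FG)))
  ... | A , A∈F , C∈AG with ∈-map⁻ (A ∩_) C∈AG
  ...   | B , B∈G , C≡A∩B = A , B , A∈F , B∈G , C≡A∩B

  prod⪯ˡ : ∀ (F G : Tuple n) → prod F G ⪯ F
  prod⪯ˡ F G = All.tabulate λ C∈FG → case ∈-prod⁻ F G C∈FG of λ
    { (A , B , A∈F , _ , refl) → lose A∈F (λ {x} → p∩q⊆p A B {x}) }

  prod⪯ʳ : ∀ (F G : Tuple n) → prod F G ⪯ G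
  prod⪯ʳ F G = All.tabulate λ C∈FG → case ∈-prod⁻ F G C∈FG of λ
    { (A , B , _ , B∈G , refl) → lose B∈G (λ {x} → p∩q⊆q A B {x}) }

  ⪯-trans : ∀ {E F H : Tuple n} → E ⪯ F → F ⪯ H → E ⪯ H
  ⪯-trans {F = F} {H} E⪯F F⪯H = All.map refine E⪯F
    where
    refine : ∀ {C} → Any (C ⊆ₛ_) F → Any (C ⊆ₛ_) H
    refine C⊆F with find C⊆F
    ... | A , A∈F , C⊆A = Any.map (⊆-trans C⊆A) (All.lookup F⪯H A∈F)

allSubsets-complete : ∀ n (s : Subset n) → s ∈ allSubsets n
allSubsets-complete zero    []      = here refl
allSubsets-complete (suc n) (b ∷ s) =
  ∈-concatMap⁺ extendBy (lose (bit∈ b) (∈-map⁺ (b ∷_) (allSubsets-complete n s)))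
  where
  extendBy : Bool → List (Subset (suc n))
  extendBy b = map (b ∷_) (allSubsets n)
  bit∈ : ∀ b → b ∈ true ∷ false ∷ []
  bit∈ true  = here refl
  bit∈ false = there (here refl)

allTuples-complete : ∀ n (T : Tuple n) → T ∈ allTuples n (length T)
allTuples-complete n []      = here refl
allTuples-complete n (A ∷ T) =
  ∈-concatMap⁺ extendBy (lose (allSubsets-complete n A) (∈-map⁺ (A ∷_) (allTuples-complete n T)))
  where
  extendBy : Subset n → List (Tuple n)
  extendBy B = map (B ∷_) (allTuples n (length T))

module _ {n : ℕ} (α : Composition n) where

  -- nα α F is literally length (filter (countedBy? F) (allTuples n (length (parts α)))).
  CountedBy : Tuple n → Pred (Tuple n) _
  CountedBy F H = IsSetComp H × typeOf H ≡ parts α × F ⪯ H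

  countedBy? : (F : Tuple n) → Decidable (CountedBy F)
  countedBy? F H = isSetComp? H ×-dec (typeEq? (typeOf H) (parts α) ×-dec F ⪯? H)

  nα-< : ∀ {E F : Tuple n} (H : SetComp n) → E ⪯ F →
         typeOf (blocks H) ≡ parts α → E ⪯ blocks H → ¬ F ⪯ blocks H →
         nα α F < nα α E
  nα-< {E} {F} H E⪯F typeH E⪯H F⋠H =
    length-filter-< (countedBy? F) (countedBy? E) weaken _ H∈allTuples
                    (isSetComp H , typeH , E⪯H) (λ (_ , _ , F⪯H) → F⋠H F⪯H)
    where
    weaken : ∀ {K} → CountedBy F K → CountedBy E K
    weaken (isK , typeK , F⪯K) = isK , typeK , ⪯-trans E⪯F F⪯K
    H∈allTuples : blocks H ∈ allTuples n (length (parts α))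
    H∈allTuples = subst (λ k → blocks H ∈ allTuples n k)
                        (trans (sym (length-map ∣_∣ (blocks H))) (cong length typeH))
                        (allTuples-complete n (blocks H))

proposition4p26 : (n : ℕ) (α : Composition n) (F G : SetComp n) →
    typeOf (blocks G) ≡ parts α → ¬ (blocks F ⪯ blocks G) →
    nα α (F · G) > nα α (blocks F)
proposition4p26 n α F G typeG F⋠G =
  nα-< α G (prod⪯ˡ (blocks F) (blocks G)) typeG (prod⪯ʳ (blocks F) (blocks G)) F⋠G
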